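{- For every $k\ge 3$ and every $t$ with $1\le t\le k$, there exists a graph $G$ with maximum degree $\Delta(G)\le k$ that is $t$-saturated and is not $(1^{k-1},3^{t})$-packing colorable.
   Context: Graphs are finite and simple; $\mathrm{dist}(x,y)$ is the usual shortest-path distance. For a non-decreasing sequence of positive integers $S=(s_1,\dots,s_p)$, an $S$-packing coloring of $G$ is a partition of $V(G)$ into sets $V_1,\dots,V_p$ such that any two distinct vertices of $V_i$ are at distance greater than $s_i$, for each $1\le i\le p$; $G$ is $S$-packing colorable if such a partition exists. The notation $i^r$ in a sequence means that $i$ is repeated $r$ times, so $(1^{k-1},3^{t})$ is the sequence of $k-1$ ones followed by $t$ threes. A vertex of degree $k$ is called a $k$-vertex. A graph $G$ with $\Delta(G)\le k$ is called $t$-saturated ($0\le t\le k$) if every $k$-vertex of $G$ is adjacent to at most $t$ vertices of degree $k$. -}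

module Defs where

open import Data.Nat using (ℕ; zero; suc; _+_; _∸_; _≤_; _<_)
open import Data.Nat.Properties using (_≟_)
open import Data.Bool using (Bool; true; false; _∧_)
open import Data.Fin using (Fin)
open import Data.Fin.Subset using (Subset; ∣_∣)
open import Data.Vec using (Vec; tabulate; replicate; lookup; _++_)
open import Data.Product using (Σ; ∃; _×_)
open import Relation.Binary.PropositionalEquality using (_≡_; _≢_)
open import Relation.Nullary using (¬_)
open import Relation.Nullary.Decidable using (⌊_⌋)

record Graph (n : ℕ) : Set where
  field
    adj   : Fin n → Fin n → Bool
    sym   : ∀ x y → adj x y ≡ adj y x
    irrefl : ∀ x → adj x x ≡ false
open Graph public

module _ {n : ℕ} (G : Graph n) where

  N : Fin n → Subset n
  N x = tabulate (adj G x)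

  deg : Fin n → ℕ
  deg x = ∣ N x ∣

  MaxDegreeAtMost : ℕ → Set
  MaxDegreeAtMost k = ∀ x → deg x ≤ k

  data Walk : Fin n → Fin n → ℕ → Set where
    here : ∀ {x} → Walk x x zero
    step : ∀ {x y z ℓ} → adj G x y ≡ true → Walk y z ℓ → Walk x z (suc ℓ)

  -- dist(x,y) ≤ s  (shortest-path distance; infinite if disconnected)
  DistAtMost : Fin n → Fin n → ℕ → Set
  DistAtMost x y s = ∃ λ ℓ → ℓ ≤ s × Walk x y ℓ

  kNeighbours : ℕ → Fin n → ℕ
  kNeighbours k x = ∣ tabulate (λ y → adj G x y ∧ ⌊ deg y ≟ k ⌋) ∣

  Saturated : ℕ → ℕ → Set
  Saturated k t = ∀ x → deg x ≡ k → kNeighbours k x ≤ t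

  -- S-packing coloring: partition V(G) into V_1..V_p via c : V → Fin p,
  -- distinct vertices of V_i are at distance > s_i
  IsPackingColoring : {p : ℕ} → Vec ℕ p → (Fin n → Fin p) → Set
  IsPackingColoring S c =
    ∀ x y → x ≢ y → c x ≡ c y → ¬ DistAtMost x y (lookup S (c x))

  PackingColorable : {p : ℕ} → Vec ℕ p → Set
  PackingColorable S = ∃ λ c → IsPackingColoring S c

oneThree : (k t : ℕ) → Vec ℕ ((k ∸ 1) + t)
oneThree k t = replicate (k ∸ 1) 1 ++ replicate t 3

-- Take t + 1 disjoint copies ("blocks") of K_k and, for every pair of blocks
-- i < j, join position j − 1 of block i to position i of block j.  Each vertex
-- gets at most one such link, and only positions below t get one, so Δ ≤ k and
-- the k-neighbours of a k-vertex are among its t − 1 block-mates at positions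
-- below t and its partner.  In a packing colouring every block is a clique on k
-- vertices while only k − 1 colours have distance 1, so every block contains a
-- vertex coloured with one of the t colours of distance 3.  By pigeonhole two
-- blocks share such a colour, but any two vertices of distinct blocks are joined
-- by a path of length 3.
module Submission where

open import Defs
open import Data.Nat
  using (ℕ; zero; suc; pred; _+_; _*_; _≤_; _<_; z≤n; s≤s; s≤s⁻¹; _≟_; _<?_; _≤?_)
open import Data.Nat.Properties
  using (≤-refl; ≤-trans; ≤-reflexive; <-≤-trans; ≤-<-trans; <⇒≢; ≰⇒>; n≮n; n<1+n; 1+n≰n;
         +-comm; +-mono-≤; module ≤-Reasoning)
open import Data.Bool using (Bool; true; false; _∧_)
open import Data.Fin as Fin using (Fin; toℕ; fromℕ<; combine; remQuot; reduce≥; inject≤)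
open import Data.Fin.Properties as Finₚ
  using (toℕ-injective; toℕ<n; toℕ-fromℕ<; fromℕ<-injective; toℕ-inject≤; suc-injective;
         combine-remQuot; remQuot-combine; combine-injectiveˡ; pigeonhole; any?)
open import Data.Fin.Subset using (∣_∣)
open import Data.Vec using (Vec; tabulate; lookup; replicate; _++_)
open import Data.Vec.Properties using (lookup-replicate; lookup-++-≥; lookup-splitAt)
open import Data.List as List using (List; []; _∷_; length; map; upTo)
open import Data.List.Properties using (length-map; length-++; length-upTo; length-removeAt′)
open import Data.List.Membership.Propositional using (_∈_; _─_)
open import Data.List.Membership.Propositional.Properties
  using (∈-map⁺; ∈-++⁺ˡ; ∈-++⁺ʳ; ∈-upTo⁺)
open import Data.List.Relation.Unary.Any using (here; there)
open import Data.Product as Product using (Σ; ∃; ∃₂; _×_; _,_; proj₁; proj₂; uncurry)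
open import Data.Product.Properties using (≡-dec; ,-injectiveˡ; ,-injectiveʳ; ×-≡,≡→≡)
open import Data.Sum using (_⊎_; inj₁; inj₂)
open import Data.Empty using (⊥; ⊥-elim)
open import Function using (_∘_)
open import Function.Definitions using (Injective)
open import Relation.Nullary using (¬_; Dec; yes; no; does; ¬?; contradiction)
open import Relation.Nullary.Decidable
  using (⌊_⌋; _×-dec_; _⊎-dec_; dec-true; dec-false; does-⇔; isYes≗does)
open import Relation.Binary.PropositionalEquality
  using (_≡_; _≢_; refl; trans; cong; subst; subst₂; module ≡-Reasoning)
  renaming (sym to ≡-sym)
open import Function.Bundles using (mk⇔)

∈-─⁺ : ∀ {A : Set} {x y : A} {xs : List A} (p : x ∈ xs) → y ∈ xs → y ≢ x → y ∈ xs ─ p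
∈-─⁺ (here refl) (here refl) y≢x = ⊥-elim (y≢x refl)
∈-─⁺ (here _)    (there q)   _   = q
∈-─⁺ (there _)   (here refl) _   = here refl
∈-─⁺ (there p)   (there q)   y≢x = there (∈-─⁺ p q y≢x)

∣tabulate∣≤length : ∀ {A : Set} {n} (f : Fin n → Bool) {g : Fin n → A} → Injective _≡_ _≡_ g →
                    (xs : List A) → (∀ y → f y ≡ true → g y ∈ xs) → ∣ tabulate f ∣ ≤ length xs
∣tabulate∣≤length {n = zero}  f g-inj xs covered = z≤n
∣tabulate∣≤length {n = suc n} f g-inj xs covered with f Fin.zero in f0
... | false = ∣tabulate∣≤length (f ∘ Fin.suc) (suc-injective ∘ g-inj) xs (covered ∘ Fin.suc)
... | true  = begin
  suc ∣ tabulate (f ∘ Fin.suc) ∣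
    ≤⟨ s≤s (∣tabulate∣≤length (f ∘ Fin.suc) (suc-injective ∘ g-inj) (xs ─ g0∈xs) rest) ⟩
  suc (length (xs ─ g0∈xs))
    ≡⟨ length-removeAt′ xs _ ⟨
  length xs
    ∎
  where
  open ≤-Reasoning
  g0∈xs = covered Fin.zero f0
  rest : ∀ y → f (Fin.suc y) ≡ true → _ ∈ xs ─ g0∈xs
  rest y fy = ∈-─⁺ g0∈xs (covered (Fin.suc y) fy) (λ e → contradiction (g-inj e) λ ())

does≡true⇒ : ∀ {A : Set} (a? : Dec A) → does a? ≡ true → A
does≡true⇒ (yes a) _  = a
does≡true⇒ (no _)  ()

∧≡true⇒ : ∀ {a b} → a ∧ b ≡ true → a ≡ true × b ≡ true
∧≡true⇒ {true} {true} _ = refl , refl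

module _ {n : ℕ} (G : Graph n) where

  Walk-++ : ∀ {x y z l m} → Walk G x y l → Walk G y z m → Walk G x z (l + m)
  Walk-++ here         w = w
  Walk-++ (step e w₁) w = step e (Walk-++ w₁ w)

  DistAtMost-trans : ∀ {x y z a b} →
                     DistAtMost G x y a → DistAtMost G y z b → DistAtMost G x z (a + b)
  DistAtMost-trans (l , l≤a , w) (m , m≤b , w′) = l + m , +-mono-≤ l≤a m≤b , Walk-++ w w′

  DistAtMost-mono : ∀ {x y a b} → DistAtMost G x y a → a ≤ b → DistAtMost G x y b
  DistAtMost-mono (l , l≤a , w) a≤b = l , ≤-trans l≤a a≤b , w

  adj⇒DistAtMost1 : ∀ {x y} → adj G x y ≡ true → DistAtMost G x y 1
  adj⇒DistAtMost1 e = 1 , ≤-refl , step e here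

  adj⇒≢ : ∀ {x y} → adj G x y ≡ true → x ≢ y
  adj⇒≢ {x} e refl = contradiction (trans (≡-sym e) (irrefl G x)) λ ()

  sameColour∧close⇒≡ : ∀ {p} (S : Vec ℕ p) {c : Fin n → Fin p} → IsPackingColoring G S c →
                       ∀ {x y} → c x ≡ c y → DistAtMost G x y (lookup S (c x)) → x ≡ y
  sameColour∧close⇒≡ S proper {x} {y} cx≡cy close with x Fin.≟ y
  ... | yes x≡y = x≡y
  ... | no  x≢y = contradiction close (proper x y x≢y cx≡cy)

  adj⇒colour≢ : ∀ {p} (S : Vec ℕ p) {c : Fin n → Fin p} → IsPackingColoring G S c →
                ∀ {x y} → 1 ≤ lookup S (c x) → adj G x y ≡ true → c x ≢ c y
  adj⇒colour≢ S proper 1≤s e cx≡cy =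
    adj⇒≢ e (sameColour∧close⇒≡ S proper cx≡cy (DistAtMost-mono (adj⇒DistAtMost1 e) 1≤s))

  clique⇒highColour : ∀ {a b} (S : Vec ℕ (a + b)) {c : Fin n → Fin (a + b)} →
    IsPackingColoring G S c → (∀ j → 1 ≤ lookup S j) →
    (v : Fin (suc a) → Fin n) → (∀ r r′ → r ≢ r′ → adj G (v r) (v r′) ≡ true) →
    ∃ λ r → a ≤ toℕ (c (v r))
  clique⇒highColour {a} S {c} proper positive v clique with any? (λ r → a ≤? toℕ (c (v r)))
  ... | yes high = high
  ... | no ¬high = clash (pigeonhole (n<1+n a) low)
    where
    low : Fin (suc a) → Fin a
    low r = fromℕ< (≰⇒> (¬high ∘ (r ,_)))
    clash : (∃₂ λ r r′ → r Fin.< r′ × low r ≡ low r′) → ∃ λ r → a ≤ toℕ (c (v r))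
    clash (r , r′ , r<r′ , sameLow) =
      contradiction sameColour (adj⇒colour≢ S proper (positive _) (clique r r′ (Finₚ.<⇒≢ r<r′)))
      where
      sameColour : c (v r) ≡ c (v r′)
      sameColour = toℕ-injective (fromℕ<-injective _ _ _ _ sameLow)

oneThree-positive : ∀ a b (j : Fin (a + b)) → 1 ≤ lookup (replicate a 1 ++ replicate b 3) j
oneThree-positive a b j rewrite lookup-splitAt a (replicate a 1) (replicate b 3) j with Fin.splitAt a j
... | inj₁ j₁ rewrite lookup-replicate j₁ 1 = ≤-refl
... | inj₂ j₂ rewrite lookup-replicate j₂ 3 = s≤s z≤n

oneThree-high : ∀ a b (j : Fin (a + b)) (a≤j : a ≤ toℕ j) →
                lookup (replicate a 1 ++ replicate b 3) j ≡ 3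
oneThree-high a b j a≤j =
  trans (lookup-++-≥ (replicate a 1) (replicate b 3) j a≤j) (lookup-replicate (reduce≥ j a≤j) 3)

reduce≥-injective : ∀ m {n} (i j : Fin (m + n)) (m≤i : m ≤ toℕ i) (m≤j : m ≤ toℕ j) →
                    reduce≥ i m≤i ≡ reduce≥ j m≤j → i ≡ j
reduce≥-injective zero    i            j            _   _   e = e
reduce≥-injective (suc m) (Fin.suc i) (Fin.suc j) m≤i m≤j e =
  cong Fin.suc (reduce≥-injective m i j (s≤s⁻¹ m≤i) (s≤s⁻¹ m≤j) e)

-- A vertex is a pair (block , position).
module LinkedCliques (k t : ℕ) where

  Link : ℕ × ℕ → ℕ × ℕ → Set
  Link (i , r) (j , s) = i < j × suc r ≡ j × s ≡ i

  Adjacent : ℕ × ℕ → ℕ × ℕ → Set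
  Adjacent u v = u ≢ v × (proj₁ u ≡ proj₁ v ⊎ Link u v ⊎ Link v u)

  adjacent? : ∀ u v → Dec (Adjacent u v)
  adjacent? u@(i , r) v@(j , s) =
    ¬? (≡-dec _≟_ _≟_ u v) ×-dec
    (i ≟ j ⊎-dec (i <? j ×-dec suc r ≟ j ×-dec s ≟ i) ⊎-dec (j <? i ×-dec suc s ≟ i ×-dec r ≟ j))

  Adjacent-sym : ∀ {u v} → Adjacent u v → Adjacent v u
  Adjacent-sym (u≢v , inj₁ same)        = u≢v ∘ ≡-sym , inj₁ (≡-sym same)
  Adjacent-sym (u≢v , inj₂ (inj₁ link)) = u≢v ∘ ≡-sym , inj₂ (inj₂ link)
  Adjacent-sym (u≢v , inj₂ (inj₂ link)) = u≢v ∘ ≡-sym , inj₂ (inj₁ link)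

  partner : ℕ × ℕ → ℕ × ℕ
  partner (i , r) with r <? i
  ... | yes _ = r , pred i
  ... | no  _ = suc r , i

  Link⇒partner : ∀ {u v} → Link u v ⊎ Link v u → v ≡ partner u
  Link⇒partner {i , r} (inj₁ (i<j , refl , refl)) with r <? i
  ... | yes r<i = contradiction (<-≤-trans r<i (s≤s⁻¹ i<j)) (n≮n r)
  ... | no  _   = refl
  Link⇒partner {i , r} (inj₂ (j<i , refl , refl)) with r <? i
  ... | yes _   = refl
  ... | no  r≮i = contradiction j<i r≮i

  Link⇒position< : ∀ {u v} → proj₁ u ≤ t → proj₁ v ≤ t → Link u v ⊎ Link v u → proj₂ u < t
  Link⇒position< _   v≤t (inj₁ (_ , refl , _))   = v≤t
  Link⇒position< u≤t _   (inj₂ (j<i , _ , refl)) = <-≤-trans j<i u≤t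

  others : (m : ℕ) (u : ℕ × ℕ) → proj₂ u < m → List (ℕ × ℕ)
  others m (i , r) r<m = map (i ,_) (upTo m ─ ∈-upTo⁺ r<m)

  length-others : ∀ m u (r<m : proj₂ u < m) → suc (length (others m u r<m)) ≡ m
  length-others m (i , r) r<m = begin
    suc (length (map (i ,_) (upTo m ─ r∈))) ≡⟨ cong suc (length-map (i ,_) (upTo m ─ r∈)) ⟩
    suc (length (upTo m ─ r∈))               ≡⟨ length-removeAt′ (upTo m) _ ⟨
    length (upTo m)                          ≡⟨ length-upTo m ⟩
    m                                        ∎
    where
    open ≡-Reasoning
    r∈ = ∈-upTo⁺ r<m

  ∈-others : ∀ m u (r<m : proj₂ u < m) {v} →
             proj₁ u ≡ proj₁ v → proj₂ v < m → v ≢ u → v ∈ others m u r<m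
  ∈-others m (i , r) r<m {j , s} refl s<m v≢u =
    ∈-map⁺ (i ,_) (∈-─⁺ (∈-upTo⁺ r<m) (∈-upTo⁺ s<m) (v≢u ∘ cong (i ,_)))

  candidates : (m : ℕ) (u : ℕ × ℕ) → proj₂ u < m → List (ℕ × ℕ)
  candidates m u r<m = others m u r<m List.++ partner u ∷ []

  length-candidates : ∀ m u (r<m : proj₂ u < m) → length (candidates m u r<m) ≡ m
  length-candidates m u r<m =
    trans (length-++ (others m u r<m)) (trans (+-comm _ 1) (length-others m u r<m))

  Adjacent⇒∈-candidates : ∀ m u (r<m : proj₂ u < m) {v} →
                          Adjacent u v → proj₂ v < m → v ∈ candidates m u r<m
  Adjacent⇒∈-candidates m u r<m (u≢v , inj₁ same) s<m =
    ∈-++⁺ˡ (∈-others m u r<m same s<m (u≢v ∘ ≡-sym))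
  Adjacent⇒∈-candidates m u r<m (u≢v , inj₂ link) s<m =
    ∈-++⁺ʳ (others m u r<m) (here (Link⇒partner link))

  n : ℕ
  n = suc t * k

  split : Fin n → Fin (suc t) × Fin k
  split = remQuot k

  cell : Fin (suc t) → Fin k → Fin n
  cell = combine

  vertex : Fin n → ℕ × ℕ
  vertex x = Product.map toℕ toℕ (split x)

  vertex-injective : Injective _≡_ _≡_ vertex
  vertex-injective {x} {y} e = begin
    x                       ≡⟨ combine-remQuot {suc t} k x ⟨
    uncurry combine (split x) ≡⟨ cong (uncurry combine) split≡ ⟩
    uncurry combine (split y) ≡⟨ combine-remQuot {suc t} k y ⟩
    y                       ∎
    where
    open ≡-Reasoning
    split≡ : split x ≡ split y
    split≡ = ×-≡,≡→≡ (toℕ-injective (cong proj₁ e) , toℕ-injective (cong proj₂ e))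

  vertex-cell : ∀ i r → vertex (cell i r) ≡ (toℕ i , toℕ r)
  vertex-cell i r = cong (Product.map toℕ toℕ) (remQuot-combine i r)

  block≤t : ∀ x → proj₁ (vertex x) ≤ t
  block≤t x = s≤s⁻¹ (toℕ<n (proj₁ (split x)))

  position<k : ∀ x → proj₂ (vertex x) < k
  position<k x = toℕ<n (proj₂ (split x))

  graph : Graph n
  graph = record
    { adj    = λ x y → does (adjacent? (vertex x) (vertex y))
    ; sym    = λ x y → does-⇔ (mk⇔ Adjacent-sym Adjacent-sym)
                                (adjacent? (vertex x) (vertex y)) (adjacent? (vertex y) (vertex x))
    ; irrefl = λ x → dec-false (adjacent? (vertex x) (vertex x)) (λ a → proj₁ a refl)
    }

  deg≤length : ∀ x (xs : List (ℕ × ℕ)) → (∀ y → Adjacent (vertex x) (vertex y) → vertex y ∈ xs) →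
               deg graph x ≤ length xs
  deg≤length x xs covered =
    ∣tabulate∣≤length (adj graph x) vertex-injective xs
      (λ y e → covered y (does≡true⇒ (adjacent? (vertex x) (vertex y)) e))

  maxDegree : MaxDegreeAtMost graph k
  maxDegree x = ≤-trans
    (deg≤length x (candidates k u r<k) (λ y a → Adjacent⇒∈-candidates k u r<k a (position<k y)))
    (≤-reflexive (length-candidates k u r<k))
    where
    u = vertex x
    r<k = position<k x

  deg≡k⇒position<t : ∀ x → deg graph x ≡ k → proj₂ (vertex x) < t
  deg≡k⇒position<t x deg≡k with proj₂ (vertex x) <? t
  ... | yes r<t = r<t
  ... | no  r≮t = contradiction (subst (_≤ length (others k u r<k)) deg≡suc bound) 1+n≰n
    where
    u = vertex x
    r<k = position<k x
    sameBlock : ∀ y → Adjacent u (vertex y) → vertex y ∈ others k u r<k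
    sameBlock y (u≢v , inj₁ same) = ∈-others k u r<k same (position<k y) (u≢v ∘ ≡-sym)
    sameBlock y (_   , inj₂ link) = contradiction (Link⇒position< (block≤t x) (block≤t y) link) r≮t
    bound = deg≤length x (others k u r<k) sameBlock
    deg≡suc = trans deg≡k (≡-sym (length-others k u r<k))

  saturated : Saturated graph k t
  saturated x deg≡k = ≤-trans
    (∣tabulate∣≤length _ vertex-injective (candidates t u r<t) covered)
    (≤-reflexive (length-candidates t u r<t))
    where
    u = vertex x
    r<t = deg≡k⇒position<t x deg≡k
    covered : ∀ y → adj graph x y ∧ ⌊ deg graph y ≟ k ⌋ ≡ true → vertex y ∈ candidates t u r<t
    covered y e with ∧≡true⇒ e
    ... | adjacent , degree = Adjacent⇒∈-candidates t u r<t
      (does≡true⇒ (adjacent? u (vertex y)) adjacent)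
      (deg≡k⇒position<t y (does≡true⇒ (deg graph y ≟ k) (trans (≡-sym (isYes≗does _)) degree)))

  cell-adj : ∀ i r j s → Adjacent (toℕ i , toℕ r) (toℕ j , toℕ s) →
             adj graph (cell i r) (cell j s) ≡ true
  cell-adj i r j s a =
    dec-true (adjacent? (vertex (cell i r)) (vertex (cell j s)))
      (subst₂ Adjacent (≡-sym (vertex-cell i r)) (≡-sym (vertex-cell j s)) a)

  sameBlock-adj : ∀ i {r s} → r ≢ s → adj graph (cell i r) (cell i s) ≡ true
  sameBlock-adj i {r} {s} r≢s = cell-adj i r i s (r≢s ∘ toℕ-injective ∘ ,-injectiveʳ , inj₁ refl)

  sameBlock-DistAtMost1 : ∀ i r s → DistAtMost graph (cell i r) (cell i s) 1
  sameBlock-DistAtMost1 i r s with r Fin.≟ s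
  ... | yes refl = 0 , z≤n , here
  ... | no  r≢s  = adj⇒DistAtMost1 graph (sameBlock-adj i r≢s)

  -- The path leaves block i at position j − 1 and enters block j at position i.
  crossBlock-DistAtMost3 : t ≤ k → ∀ {i j : Fin (suc t)} (r s : Fin k) → i Fin.< j →
                           DistAtMost graph (cell i r) (cell j s) 3
  crossBlock-DistAtMost3 t≤k {i} {Fin.suc j} r s i<j =
    DistAtMost-trans graph (sameBlock-DistAtMost1 i r exit)
      (DistAtMost-trans graph (adj⇒DistAtMost1 graph bridge) (sameBlock-DistAtMost1 (Fin.suc j) entry s))
    where
    exit : Fin k
    exit = inject≤ j t≤k
    entry : Fin k
    entry = fromℕ< (<-≤-trans (≤-<-trans (s≤s⁻¹ i<j) (toℕ<n j)) t≤k)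
    bridge : adj graph (cell i exit) (cell (Fin.suc j) entry) ≡ true
    bridge = cell-adj i exit (Fin.suc j) entry
      (<⇒≢ i<j ∘ ,-injectiveˡ , inj₂ (inj₁ (i<j , cong suc (toℕ-inject≤ j t≤k) , toℕ-fromℕ< _)))

linkedCliques-¬colourable : ∀ k₁ t → t ≤ suc k₁ →
  ¬ PackingColorable (LinkedCliques.graph (suc k₁) t) (oneThree (suc k₁) t)
linkedCliques-¬colourable k₁ t t≤k (c , proper) = clash (pigeonhole (n<1+n t) highColour)
  where
  open LinkedCliques (suc k₁) t
  S = oneThree (suc k₁) t
  high : ∀ i → ∃ λ r → k₁ ≤ toℕ (c (cell i r))
  high i = clique⇒highColour graph S proper (oneThree-positive k₁ t) (cell i) (λ _ _ → sameBlock-adj i)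
  highColour : Fin (suc t) → Fin t
  highColour i = reduce≥ (c (cell i (proj₁ (high i)))) (proj₂ (high i))
  clash : (∃₂ λ i j → i Fin.< j × highColour i ≡ highColour j) → ⊥
  clash (i , j , i<j , sameHigh) =
    Finₚ.<⇒≢ i<j (combine-injectiveˡ _ _ _ _ (sameColour∧close⇒≡ graph S proper sameColour close))
    where
    x = cell i (proj₁ (high i))
    y = cell j (proj₁ (high j))
    sameColour : c x ≡ c y
    sameColour = reduce≥-injective k₁ (c x) (c y) (proj₂ (high i)) (proj₂ (high j)) sameHigh
    close : DistAtMost graph x y (lookup S (c x))
    close = subst (DistAtMost graph x y) (≡-sym (oneThree-high k₁ t (c x) (proj₂ (high i))))
                  (crossBlock-DistAtMost3 t≤k (proj₁ (high i)) (proj₁ (high j)) i<j)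

proposition6p1 : (k t : ℕ) → 3 ≤ k → 1 ≤ t → t ≤ k →
    Σ ℕ λ n → Σ (Graph n) λ G →
      MaxDegreeAtMost G k × Saturated G k t × ¬ PackingColorable G (oneThree k t)
proposition6p1 (suc k₁) t _ _ t≤k =
  n , graph , maxDegree , saturated , linkedCliques-¬colourable k₁ t t≤k
  where open LinkedCliques (suc k₁) t
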